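{- Let $\Lambda_h=\begin{bmatrix}1&-\frac12\\0&\frac{\sqrt3}{2}\end{bmatrix}\mathbb{Z}^2$. For every well-rounded sublattice $\Gamma\subseteq\Lambda_h$, $$\cos\theta(\Gamma)=\frac pq\le\frac12,\qquad \sin\theta(\Gamma)=\frac rq\sqrt3\ge\frac{\sqrt3}{2},$$ for some relatively prime triple $(p,r,q)\in\mathbb{Z}^3_{\ge0}$.
   Context: For a lattice $\Gamma\subset\mathbb{R}^2$, $|\Gamma|=\min\{\|y\|^2:y\in\Gamma\setminus\{0\}\}$; vectors attaining this minimum are minimal vectors. $\Gamma$ is well-rounded if it has a basis of two minimal vectors (a minimal basis). A minimal basis can always be chosen with angle in $[\pi/3,\pi/2]$, and this angle is independent of the choice; it is denoted $\theta(\Gamma)$. -}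

module Defs where

open import Data.Integer using (ℤ; _+_; _-_; _*_; _≤_; +_; ∣_∣)
open import Data.Nat as ℕ using (ℕ)
open import Data.Nat.GCD using (gcd)
open import Data.Product using (_×_; _,_; ∃-syntax)
open import Relation.Binary.PropositionalEquality using (_≡_; _≢_)

-- Λ_h = B ℤ² with B = [[1, -1/2], [0, √3/2]].  A point of Λ_h is represented
-- by its integer coordinate vector (a , b) ∈ ℤ², i.e. the point B (a , b).
V : Set
V = ℤ × ℤ

0V : V
0V = (+ 0 , + 0)

_⊕_ : V → V → V
(a , b) ⊕ (c , d) = (a + c , b + d)

_·_ : ℤ → V → V
m · (a , b) = (m * a , m * b)

-- ‖B(a,b)‖² = a² - ab + b²   (exact, integer valued)
sqNorm : V → ℤ
sqNorm (a , b) = a * a - a * b + b * b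

-- 2 ⟨B(a,b), B(c,d)⟩ = 2ac + 2bd - ad - bc
twoInner : V → V → ℤ
twoInner (a , b) (c , d) = (+ 2) * (a * c) + (+ 2) * (b * d) - a * d - b * c

-- integer determinant; det(Bx, By) = (√3/2) · det x y
det : V → V → ℤ
det (a , b) (c , d) = a * d - b * c

record Sublattice : Set where
  constructor sublattice
  field
    g₁ g₂ : V
    indep : det g₁ g₂ ≢ + 0

_∈_ : V → Sublattice → Set
z ∈ Γ = ∃[ m ] ∃[ n ] (z ≡ (m · Sublattice.g₁ Γ) ⊕ (n · Sublattice.g₂ Γ))

IsMinimal : Sublattice → V → Set
IsMinimal Γ x = x ∈ Γ × x ≢ 0V × (∀ y → y ∈ Γ → y ≢ 0V → sqNorm x ≤ sqNorm y)

IsBasis : Sublattice → V → V → Set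
IsBasis Γ x y = x ∈ Γ × y ∈ Γ × det x y ≢ + 0
              × (∀ z → z ∈ Γ → ∃[ m ] ∃[ n ] (z ≡ (m · x) ⊕ (n · y)))

IsMinimalBasis : Sublattice → V → V → Set
IsMinimalBasis Γ x y = IsMinimal Γ x × IsMinimal Γ y × IsBasis Γ x y

WellRounded : Sublattice → Set
WellRounded Γ = ∃[ x ] ∃[ y ] IsMinimalBasis Γ x y

-- angle between x and y (with ‖x‖ = ‖y‖) lies in [π/3, π/2], i.e.
-- 0 ≤ cos = ⟨x,y⟩/‖x‖² ≤ 1/2, i.e. 0 ≤ 2⟨x,y⟩ ≤ ‖x‖².
AngleIn[π/3,π/2] : V → V → Set
AngleIn[π/3,π/2] x y = + 0 ≤ twoInner x y × twoInner x y ≤ sqNorm x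

-- For a minimal basis x , y realising θ = θ(Γ):
--   cos θ = ⟨x,y⟩/‖x‖² = twoInner x y / (2 ‖x‖²)
--   sin θ = |det(Bx,By)|/‖x‖² = √3 · |det x y| / (2 ‖x‖²)
-- "cos θ = p/q"  ⟺  q · twoInner x y = 2 · sqNorm x · p
CosIs : V → V → ℕ → ℕ → Set
CosIs x y p q = (+ q) * twoInner x y ≡ (+ 2) * sqNorm x * (+ p)

-- "sin θ = (r/q)√3"  ⟺  q · |det x y| = 2 · sqNorm x · r
SinIs√3 : V → V → ℕ → ℕ → Set
SinIs√3 x y r q = (+ q) * (+ ∣ det x y ∣) ≡ (+ 2) * sqNorm x * (+ r)

RelPrimeTriple : ℕ → ℕ → ℕ → Set
RelPrimeTriple p r q = gcd (gcd p r) q ≡ 1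

{-# OPTIONS --safe #-}
module Submission where

open import Data.Integer as ℤ using (+_; ∣_∣)
import Data.Integer.Properties as ℤ
open import Data.Integer.Tactic.RingSolver using (solve-∀)
open import Data.Nat using (_+_; _*_; _≤_; _<_; NonZero; ≢-nonZero; ≢-nonZero⁻¹)
open import Data.Nat.Divisibility using (_∣_; ∣-trans)
open import Data.Nat.GCD using (gcd; gcd[m,n]∣m; gcd[m,n]∣n; gcd[m,n]≢0; c*gcd[m,n]≡gcd[cm,cn])
open import Data.Nat.Properties
open import Data.Product using (_×_; _,_; ∃-syntax)
open import Data.Sum using (inj₁; inj₂)
open import Function using (_∘_)
open import Relation.Binary.PropositionalEquality
open import Relation.Nullary using (contradiction)

open import Defs

-- For a minimal basis x, y we have ‖x‖ = ‖y‖, so the Lagrange identity of the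
-- hexagonal form, (2⟨x,y⟩)² + 3 det(x,y)² = 4‖x‖²‖y‖², becomes t² + 3d² = (2n)²
-- with t = 2⟨x,y⟩, d = |det(x,y)| and n = ‖x‖².  Hence cos θ = t/2n and
-- sin θ = (d/2n)√3, and dividing t, d and 2n by their gcd gives the coprime
-- triple (p, r, q).  The angle condition says t ≤ n, and then the identity
-- forces n ≤ d, which is sin θ ≥ √3/2.

divide-by-gcd₃ : ∀ a b c → c ≢ 0 →
  ∃[ g ] ∃[ p ] ∃[ r ] ∃[ q ]
    (g ≢ 0 × a ≡ g * p × b ≡ g * r × c ≡ g * q × gcd (gcd p r) q ≡ 1)
divide-by-gcd₃ a b c c≢0 = g , p , r , q , g≢0 , a≡gp , b≡gr , c≡gq , coprime
  where
  g = gcd (gcd a b) c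
  g≢0 = gcd[m,n]≢0 (gcd a b) c (inj₂ c≢0)
  instance _ = ≢-nonZero g≢0
  open _∣_ (∣-trans (gcd[m,n]∣m (gcd a b) c) (gcd[m,n]∣m a b)) renaming (quotient to p; equality to a≡pg)
  open _∣_ (∣-trans (gcd[m,n]∣m (gcd a b) c) (gcd[m,n]∣n a b)) renaming (quotient to r; equality to b≡rg)
  open _∣_ (gcd[m,n]∣n (gcd a b) c) renaming (quotient to q; equality to c≡qg)
  a≡gp = trans a≡pg (*-comm p g)
  b≡gr = trans b≡rg (*-comm r g)
  c≡gq = trans c≡qg (*-comm q g)
  coprime : gcd (gcd p r) q ≡ 1
  coprime = *-cancelˡ-≡ (gcd (gcd p r) q) 1 g (begin
    g * gcd (gcd p r) q           ≡⟨ c*gcd[m,n]≡gcd[cm,cn] g (gcd p r) q ⟩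
    gcd (g * gcd p r) (g * q)     ≡⟨ cong (λ e → gcd e (g * q)) (c*gcd[m,n]≡gcd[cm,cn] g p r) ⟩
    gcd (gcd (g * p) (g * r)) (g * q) ≡⟨ cong₂ (λ e f → gcd (gcd e f) (g * q)) a≡gp b≡gr ⟨
    gcd (gcd a b) (g * q)         ≡⟨ cong (gcd (gcd a b)) c≡gq ⟨
    g                             ≡⟨ *-identityʳ g ⟨
    g * 1                         ∎)
    where open ≡-Reasoning

cross-multiply : ∀ g p q {a c} → a ≡ g * p → c ≡ g * q → q * a ≡ c * p
cross-multiply g p q refl refl = begin
  q * (g * p) ≡⟨ *-assoc q g p ⟨
  q * g * p   ≡⟨ cong (_* p) (*-comm q g) ⟩
  g * q * p   ∎
  where open ≡-Reasoning

scale-quotient : ∀ k g p {a} → a ≡ g * p → k * a ≡ g * (k * p)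
scale-quotient k g p refl = begin
  k * (g * p) ≡⟨ *-assoc k g p ⟨
  k * g * p   ≡⟨ cong (_* p) (*-comm k g) ⟩
  g * k * p   ≡⟨ *-assoc g k p ⟩
  g * (k * p) ∎
  where open ≡-Reasoning

quotient-cancel-≤ : ∀ g p q {a c} .{{_ : NonZero g}} → a ≡ g * p → c ≡ g * q → a ≤ c → p ≤ q
quotient-cancel-≤ g p q refl refl = *-cancelˡ-≤ g

t²+3d²≡4n²∧t≤n⇒n≤d : ∀ t d n → t * t + 3 * (d * d) ≡ 4 * (n * n) → t ≤ n → n ≤ d
t²+3d²≡4n²∧t≤n⇒n≤d t d n eq t≤n with ≤-<-connex n d
... | inj₁ n≤d = n≤d
... | inj₂ d<n = contradiction eq (<⇒≢ (+-mono-≤-< (*-mono-≤ t≤n t≤n) (*-monoʳ-< 3 (*-mono-< d<n d<n))))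

t²+3d²≡4n²∧d≢0⇒n≢0 : ∀ t d n → t * t + 3 * (d * d) ≡ 4 * (n * n) → d ≢ 0 → n ≢ 0
t²+3d²≡4n²∧d≢0⇒n≢0 t d .0 eq d≢0 refl =
  ≢-nonZero⁻¹ (3 * (d * d)) {{m*n≢0 3 (d * d) {{_}} {{m*n≢0 d d}}}} (m+n≡0⇒n≡0 (t * t) eq)
  where instance _ = ≢-nonZero d≢0

t²+3d²≡4n²⇒reduced-cos-sin : ∀ t d n → t * t + 3 * (d * d) ≡ 4 * (n * n) → t ≤ n → d ≢ 0 →
  ∃[ p ] ∃[ r ] ∃[ q ] (0 < q × gcd (gcd p r) q ≡ 1
    × q * t ≡ 2 * n * p × 2 * p ≤ q × q * d ≡ 2 * n * r × q ≤ 2 * r)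
t²+3d²≡4n²⇒reduced-cos-sin t d n eq t≤n d≢0 = reduce (divide-by-gcd₃ t d (2 * n) 2n≢0)
  where
  2n≢0 : 2 * n ≢ 0
  2n≢0 = ≢-nonZero⁻¹ (2 * n) {{m*n≢0 2 n {{_}} {{≢-nonZero (t²+3d²≡4n²∧d≢0⇒n≢0 t d n eq d≢0)}}}}

  reduce : ∃[ g ] ∃[ p ] ∃[ r ] ∃[ q ]
             (g ≢ 0 × t ≡ g * p × d ≡ g * r × 2 * n ≡ g * q × gcd (gcd p r) q ≡ 1) →
           ∃[ p ] ∃[ r ] ∃[ q ] (0 < q × gcd (gcd p r) q ≡ 1
             × q * t ≡ 2 * n * p × 2 * p ≤ q × q * d ≡ 2 * n * r × q ≤ 2 * r)
  reduce (g , p , r , q , g≢0 , t≡gp , d≡gr , 2n≡gq , coprime) =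
    p , r , q , n≢0⇒n>0 q≢0 , coprime
      , cross-multiply g p q t≡gp 2n≡gq
      , quotient-cancel-≤ g (2 * p) q (scale-quotient 2 g p t≡gp) 2n≡gq (*-monoʳ-≤ 2 t≤n)
      , cross-multiply g r q d≡gr 2n≡gq
      , quotient-cancel-≤ g q (2 * r) 2n≡gq (scale-quotient 2 g r d≡gr)
          (*-monoʳ-≤ 2 (t²+3d²≡4n²∧t≤n⇒n≤d t d n eq t≤n))
    where
    instance _ = ≢-nonZero g≢0
    q≢0 : q ≢ 0
    q≢0 refl = 2n≢0 (trans 2n≡gq (*-zeroʳ g))

i*i≡+∣i∣*∣i∣ : ∀ i → i ℤ.* i ≡ + (∣ i ∣ * ∣ i ∣)
i*i≡+∣i∣*∣i∣ (+ n)      = sym (ℤ.pos-* n n)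
i*i≡+∣i∣*∣i∣ ℤ.-[1+ n ] = refl

∣∣-preserves-t²+3d²≡4n² : ∀ t d n →
  t ℤ.* t ℤ.+ + 3 ℤ.* (d ℤ.* d) ≡ + 4 ℤ.* (n ℤ.* n) →
  ∣ t ∣ * ∣ t ∣ + 3 * (∣ d ∣ * ∣ d ∣) ≡ 4 * (∣ n ∣ * ∣ n ∣)
∣∣-preserves-t²+3d²≡4n² t d n eq = ℤ.+-injective (begin
  + (∣ t ∣ * ∣ t ∣ + 3 * (∣ d ∣ * ∣ d ∣))     ≡⟨ ℤ.pos-+ (∣ t ∣ * ∣ t ∣) _ ⟩
  + (∣ t ∣ * ∣ t ∣) ℤ.+ + (3 * (∣ d ∣ * ∣ d ∣)) ≡⟨ cong₂ ℤ._+_ (sym (i*i≡+∣i∣*∣i∣ t)) (ℤ.pos-* 3 (∣ d ∣ * ∣ d ∣)) ⟩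
  t ℤ.* t ℤ.+ + 3 ℤ.* + (∣ d ∣ * ∣ d ∣)        ≡⟨ cong (λ e → t ℤ.* t ℤ.+ + 3 ℤ.* e) (sym (i*i≡+∣i∣*∣i∣ d)) ⟩
  t ℤ.* t ℤ.+ + 3 ℤ.* (d ℤ.* d)               ≡⟨ eq ⟩
  + 4 ℤ.* (n ℤ.* n)                           ≡⟨ cong (+ 4 ℤ.*_) (i*i≡+∣i∣*∣i∣ n) ⟩
  + 4 ℤ.* + (∣ n ∣ * ∣ n ∣)                    ≡⟨ ℤ.pos-* 4 (∣ n ∣ * ∣ n ∣) ⟨
  + (4 * (∣ n ∣ * ∣ n ∣))                      ∎)
  where open ≡-Reasoning

q*a≡2m*p⇒+q*+a≡+2*+m*+p : ∀ q a m p → q * a ≡ 2 * m * p → + q ℤ.* + a ≡ + 2 ℤ.* + m ℤ.* + p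
q*a≡2m*p⇒+q*+a≡+2*+m*+p q a m p eq = begin
  + q ℤ.* + a         ≡⟨ ℤ.pos-* q a ⟨
  + (q * a)           ≡⟨ cong +_ eq ⟩
  + (2 * m * p)       ≡⟨ ℤ.pos-* (2 * m) p ⟩
  + (2 * m) ℤ.* + p   ≡⟨ cong (ℤ._* + p) (ℤ.pos-* 2 m) ⟩
  + 2 ℤ.* + m ℤ.* + p ∎
  where open ≡-Reasoning

T²+3D²≡4N²⇒reduced-cos-sin : ∀ T D N →
  T ℤ.* T ℤ.+ + 3 ℤ.* (D ℤ.* D) ≡ + 4 ℤ.* (N ℤ.* N) →
  + 0 ℤ.≤ T → T ℤ.≤ N → D ≢ + 0 →
  ∃[ p ] ∃[ r ] ∃[ q ] (0 < q × gcd (gcd p r) q ≡ 1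
    × + q ℤ.* T ≡ + 2 ℤ.* N ℤ.* + p × 2 * p ≤ q
    × + q ℤ.* + ∣ D ∣ ≡ + 2 ℤ.* N ℤ.* + r × q ≤ 2 * r)
-- 0 ≤ T ≤ N makes both T and N non-negative, so they match as + t and + n.
T²+3D²≡4N²⇒reduced-cos-sin (+ t) D (+ n) eq _ (ℤ.+≤+ t≤n) D≢0 =
  let p , r , q , 0<q , coprime , cos , 2p≤q , sin , q≤2r =
        t²+3d²≡4n²⇒reduced-cos-sin t ∣ D ∣ n
          (∣∣-preserves-t²+3d²≡4n² (+ t) D (+ n) eq) t≤n (D≢0 ∘ ℤ.∣i∣≡0⇒i≡0)
  in p , r , q , 0<q , coprime
       , q*a≡2m*p⇒+q*+a≡+2*+m*+p q t n p cos , 2p≤q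
       , q*a≡2m*p⇒+q*+a≡+2*+m*+p q ∣ D ∣ n r sin , q≤2r

twoInner²+3det²≡4sqNorm² : ∀ x y →
  twoInner x y ℤ.* twoInner x y ℤ.+ + 3 ℤ.* (det x y ℤ.* det x y)
    ≡ + 4 ℤ.* (sqNorm x ℤ.* sqNorm y)
twoInner²+3det²≡4sqNorm² (a , b) (c , d) = lagrange a b c d
  where
  lagrange : ∀ a b c d →
    let t = + 2 ℤ.* (a ℤ.* c) ℤ.+ + 2 ℤ.* (b ℤ.* d) ℤ.- a ℤ.* d ℤ.- b ℤ.* c
        δ = a ℤ.* d ℤ.- b ℤ.* c
    in t ℤ.* t ℤ.+ + 3 ℤ.* (δ ℤ.* δ)
         ≡ + 4 ℤ.* ((a ℤ.* a ℤ.- a ℤ.* b ℤ.+ b ℤ.* b) ℤ.* (c ℤ.* c ℤ.- c ℤ.* d ℤ.+ d ℤ.* d))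
  lagrange = solve-∀

minimal⇒sqNorm≡ : ∀ {Γ x y} → IsMinimal Γ x → IsMinimal Γ y → sqNorm x ≡ sqNorm y
minimal⇒sqNorm≡ (x∈Γ , x≢0 , x-min) (y∈Γ , y≢0 , y-min) =
  ℤ.≤-antisym (x-min _ y∈Γ y≢0) (y-min _ x∈Γ x≢0)

lemma3p1 : (Γ : Sublattice) → WellRounded Γ →
    ∀ x y → IsMinimalBasis Γ x y → AngleIn[π/3,π/2] x y →
    ∃[ p ] ∃[ r ] ∃[ q ] (0 < q × RelPrimeTriple p r q
      × CosIs x y p q × 2 * p ≤ q
      × SinIs√3 x y r q × q ≤ 2 * r)
lemma3p1 Γ _ x y (x-min , y-min , _ , _ , det≢0 , _) (0≤T , T≤N) =
  T²+3D²≡4N²⇒reduced-cos-sin (twoInner x y) (det x y) (sqNorm x) t²+3d²≡4n² 0≤T T≤N det≢0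
  where
  t²+3d²≡4n² : twoInner x y ℤ.* twoInner x y ℤ.+ + 3 ℤ.* (det x y ℤ.* det x y)
                 ≡ + 4 ℤ.* (sqNorm x ℤ.* sqNorm x)
  t²+3d²≡4n² = trans (twoInner²+3det²≡4sqNorm² x y)
                      (cong (λ s → + 4 ℤ.* (sqNorm x ℤ.* s)) (minimal⇒sqNorm≡ {Γ} y-min x-min))
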